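{- Let $H = (V, E)$ be a hypergraph of arity $d$ with $N$ vertices and $M$ hyperedges, let $\beta \in [0,1]$, and let $t$ be a positive integer. Suppose that (1) $t$ divides $M$, (2) $1/t > \beta$, and (3) every vertex subset $V' \subseteq V$ fully contains at most $(|V'|/N)^d M + \beta M$ hyperedges. Let $\mathbf{P} \in \{0,1\}^{M \times N}$ be the indicator matrix of $H$. Then for all positive integers $q$, all $(t,q)$-legal subsets $E' \subseteq [M]^q$, and all $\delta \in [0,1]$: if $|E'| > \frac{M^q\delta^d}{(1 - \beta t)^q}$, then $|N^{(q)}_{\mathbf{P}}(E')| > N^q\delta$.
   Context: The indicator matrix of a hypergraph of arity $d$ with $N$ vertices and $M$ hyperedges is $\mathbf{P}\in\{0,1\}^{M\times N}$ with one column per vertex and one row per hyperedge, each row having $1$s exactly at the $d$ vertices of that hyperedge; a vertex subset fully contains a hyperedge if all its vertices lie in the subset. For $e\in[M]$, $N^{(1)}_{\mathbf{P}}(e)\subseteq[N]$ is the set of $d$ columns where row $e$ of $\mathbf{P}$ is nonzero. For $\mathbf{e}=(e_1,\dots,e_q)\in[M]^q$, $N^{(q)}_{\mathbf{P}}(\mathbf{e})=N^{(1)}_{\mathbf{P}}(e_1)\times\cdots\times N^{(1)}_{\mathbf{P}}(e_q)\subseteq[N]^q$ (the support of row $\mathbf{e}$ of $\mathbf{P}^{\otimes q}$), and for $E'\subseteq[M]^q$, $N^{(q)}_{\mathbf{P}}(E')=\bigcup_{\mathbf{e}\in E'}N^{(q)}_{\mathbf{P}}(\mathbf{e})$. A subset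 $E'\subseteq[M]^q$ is $(t,q)$-legal if for all $\ell\in[q]$ and all $e_1,\dots,e_{\ell-1},e_{\ell+1},\dots,e_q\in[M]$, the intersection $E'\cap\{(e_1,\dots,e_{\ell-1},e'_\ell,e_{\ell+1},\dots,e_q):e'_\ell\in[M]\}$ has cardinality either $0$ or at least $M/t$.
   Formalization: The parameters β and δ are taken as rational numbers in $[0,1]$. -}

module Defs where

open import Data.Bool using (Bool; true; false; _∧_)
open import Data.Nat using (ℕ; zero; suc)
open import Data.Fin using (Fin)
open import Data.Fin.Subset using (Subset; _⊆_)
open import Data.Fin.Subset.Properties using (_⊆?_)
open import Data.Vec using (Vec; []; _∷_; lookup; _[_]≔_)
import Data.Vec as Vec
open import Data.List using (List; length; filter; filterᵇ; allFin; concatMap; map; [_])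
open import Data.Bool.ListAction using (any)
open import Data.Integer using (+_)
open import Data.Rational using (ℚ; _/_; _*_; 1ℚ)

ℕ→ℚ : ℕ → ℚ
ℕ→ℚ n = + n / 1

_^ℚ_ : ℚ → ℕ → ℚ
x ^ℚ zero = 1ℚ
x ^ℚ suc n = x * (x ^ℚ n)

-- An indicator matrix P ∈ {0,1}^{M×N} is given row by row: row e is the
-- subset N^(1)_P(e) ⊆ [N] of columns where it is nonzero.
IndicatorMatrix : ℕ → ℕ → Set
IndicatorMatrix M N = Fin M → Subset N

tuples : (M q : ℕ) → List (Vec (Fin M) q)
tuples M zero = [ [] ]
tuples M (suc q) = concatMap (λ i → map (i ∷_) (tuples M q)) (allFin M)

TupleSet : ℕ → ℕ → Set
TupleSet M q = Vec (Fin M) q → Bool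

cardT : ∀ {M q} → TupleSet M q → ℕ
cardT {M} {q} E' = length (filterᵇ E' (tuples M q))

containedCount : ∀ {M N} → IndicatorMatrix M N → Subset N → ℕ
containedCount {M} P V' = length (filter (λ e → P e ⊆? V') (allFin M))

inProd : ∀ {N q} → Vec (Subset N) q → Vec (Fin N) q → Bool
inProd [] [] = true
inProd (S ∷ Ss) (x ∷ xs) = lookup S x ∧ inProd Ss xs

-- v ∈ N^(q)_P(e) = N^(1)_P(e₁) × ⋯ × N^(1)_P(e_q)
inNbr : ∀ {M N q} → IndicatorMatrix M N → Vec (Fin M) q → Vec (Fin N) q → Bool
inNbr P e v = inProd (Vec.map P e) v

-- v ∈ N^(q)_P(E') = ⋃_{e ∈ E'} N^(q)_P(e)
inNbrSet : ∀ {M N q} → IndicatorMatrix M N → TupleSet M q → Vec (Fin N) q → Bool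
inNbrSet {M} {N} {q} P E' v = any (λ e → E' e ∧ inNbr P e v) (tuples M q)

nbrCard : ∀ {M N q} → IndicatorMatrix M N → TupleSet M q → ℕ
nbrCard {M} {N} {q} P E' = length (filterᵇ (inNbrSet P E') (tuples N q))

lineCount : ∀ {M q} → TupleSet M q → Fin q → Vec (Fin M) q → ℕ
lineCount {M} E' ℓ e = length (filterᵇ (λ x → E' (e [ ℓ ]≔ x)) (allFin M))

module Submission where

-- Let c = 1 − βt. By induction on q, every (t,q)-legal E ⊆ [M]^q satisfies
--   c^q · N^{qd} · |E| ≤ M^q · |N(E)|^d,
-- which is incompatible with |E| > M^q δ^d / c^q and |N(E)| ≤ N^q δ. For d = 0 it is just
-- |E| ≤ M^q, so let d ≥ 1.
-- For E ⊆ [M]^{q+1} let E_e be the slice of tuples starting with the hyperedge e and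
-- L_v = ⋃_{v ∈ e} E_e the link of a vertex v; links are legal again, and N(E) is the disjoint
-- union of the sets {v} × N(L_v). If |E_e| > s then e lies inside U_s = {v : |L_v| > s}, so
-- sparseness applied to every layer s < h = max_e |E_e| gives N^d |E| ≤ M Σ_s |U_s|^d + h β M N^d,
-- while legality in the first coordinate gives h M ≤ t |E|; hence c N^d |E| ≤ M Σ_s |U_s|^d.
-- Expanding |U_s|^d as a sum over d-tuples of vertices, the tuple (v_1, …, v_d) contributes
-- min_i |L_{v_i}| (capped at h), and the induction hypothesis c^q N^{qd} |L_v| ≤ M^q |N(L_v)|^d
-- applied to each v_i bounds c^q N^{qd} times this minimum by M^q ∏_i |N(L_{v_i})|. Summing over
-- tuples gives M^q (Σ_v |N(L_v)|)^d = M^q |N(E)|^d, which closes the induction.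

open import Defs
open import Data.Nat using (ℕ; NonZero)
open import Data.Nat.Divisibility using (_∣_)
open import Data.Nat.DivMod using (_/_)
import Data.Nat as ℕ
open import Data.Fin using (Fin)
open import Data.Fin.Subset using (Subset; ∣_∣)
open import Data.Vec using (Vec)
open import Data.Sum using (_⊎_)
open import Function.Definitions using (Injective)
open import Relation.Binary.PropositionalEquality using (_≡_)
open import Data.Integer using (+_)
open import Data.Rational using (ℚ; _+_; _*_; _-_; _≤_; _<_; 0ℚ; 1ℚ)
import Data.Rational as ℚ

open import Level using (Level)
import Data.Nat.Properties as ℕ
open import Algebra.Properties.CommutativeSemigroup ℕ.+-commutativeSemigroup using (interchange)
open import Data.Nat.DivMod using (m/n*n≡m)
open import Data.Nat.Coprimality using (1-coprimeTo)
import Data.Nat.Coprimality as Coprime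
import Data.Integer as ℤ
import Data.Integer.Properties as ℤ
import Data.Rational.Properties as ℚ
import Data.Rational.Unnormalised as ℚᵘ
import Data.Rational.Unnormalised.Properties as ℚᵘ
open import Data.Bool using (Bool; true; false; T; _∧_; _∨_)
open import Data.Bool.Properties using (T-∧; T-≡; ∧-identityʳ; ∨-identityʳ)
open import Data.Bool.ListAction using (any)
open import Data.List using (List; []; _∷_; _++_; length; filter; filterᵇ; allFin; concatMap; map; tabulate; downFrom)
open import Data.List.Properties using (length-tabulate; map-tabulate; length-downFrom)
open import Data.List.Membership.Propositional using (_∈_; lose)
open import Data.List.Membership.Propositional.Properties using (∈-allFin; ∈-filter⁻; ∈-map⁺; ∈-map⁻; ∈-concatMap⁺)
open import Data.List.Relation.Unary.Any using (here; there; satisfied)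
open import Data.List.Relation.Unary.Any.Properties using (any⁺; any⁻)
open import Data.List.Extrema.Nat using (max; v≤max⁺; argmax-sel)
import Data.Fin as Fin
import Data.Fin.Subset as Subset
open import Data.Fin.Subset.Properties using (_⊆?_)
open import Data.Vec using ([]; _∷_; _[_]≔_; lookup)
import Data.Vec as Vec
import Data.Vec.Properties as Vec
open import Data.Vec.Membership.Propositional using () renaming (_∈_ to _∈ᵛ_)
import Data.Vec.Relation.Unary.Any as Anyᵛ
open import Data.Product using (∃; _×_; _,_; proj₂)
open import Data.Sum using (inj₁; inj₂)
open import Data.Empty using (⊥-elim)
open import Function using (_∘_; id; Equivalence)
open import Relation.Nullary using (Dec; does; yes; no; contradiction)
open import Relation.Nullary.Decidable using (T?; dec-true; dec⇒maybe)
open import Relation.Nullary.Reflects using (ofʸ; ofⁿ)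
open import Relation.Unary using (Pred; Decidable)
open import Relation.Binary.PropositionalEquality using (_≢_; refl; sym; trans; cong; cong₂; subst; subst₂; module ≡-Reasoning)
open import Tactic.RingSolver using (solve-∀)
open import Tactic.RingSolver.Core.AlmostCommutativeRing using (AlmostCommutativeRing; fromCommutativeRing)

private
  variable
    a b p : Level
    A : Set a
    B : Set b

T-injective : ∀ {b c} → (T b → T c) → (T c → T b) → b ≡ c
T-injective {false} {false} _   _   = refl
T-injective {false} {true}  _   c⇒b = ⊥-elim (c⇒b _)
T-injective {true}  {false} b⇒c _   = ⊥-elim (b⇒c _)
T-injective {true}  {true}  _   _   = refl

T-∧⁺ : ∀ {b c} → T b → T c → T (b ∧ c)
T-∧⁺ Tb Tc = Equivalence.from T-∧ (Tb , Tc)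

T-∧⁻ : ∀ {b c} → T (b ∧ c) → T b × T c
T-∧⁻ = Equivalence.to T-∧

T-any⁺ : ∀ (q : A → Bool) {xs x} → x ∈ xs → T (q x) → T (any q xs)
T-any⁺ q x∈xs qx = any⁺ q (lose x∈xs qx)

T-any⁻ : ∀ (q : A → Bool) xs → T (any q xs) → ∃ (T ∘ q)
T-any⁻ q xs h = satisfied (any⁻ q xs h)

T-does : ∀ {P : Set p} (P? : Dec P) → P → T (does P?)
T-does P? x = subst T (sym (dec-true P? x)) _

T-lookup⇒∈ : ∀ {n} {S : Subset n} {v} → T (lookup S v) → v Subset.∈ S
T-lookup⇒∈ {S = S} {v} h = Vec.lookup⇒[]= v S (Equivalence.to T-≡ h)

∈⇒T-lookup : ∀ {n} {S : Subset n} {v} → v Subset.∈ S → T (lookup S v)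
∈⇒T-lookup v∈S = Equivalence.from T-≡ (Vec.[]=⇒lookup v∈S)

𝟙 : Bool → ℕ
𝟙 true  = 1
𝟙 false = 0

𝟙≤1 : ∀ b → 𝟙 b ℕ.≤ 1
𝟙≤1 true  = ℕ.≤-refl
𝟙≤1 false = ℕ.z≤n

T⇒𝟙≡1 : ∀ {b} → T b → 𝟙 b ≡ 1
T⇒𝟙≡1 {true} _ = refl

𝟙-mono : ∀ {b c} → (T b → T c) → 𝟙 b ℕ.≤ 𝟙 c
𝟙-mono {false}         _   = ℕ.z≤n
𝟙-mono {true}  {true}  _   = ℕ.≤-refl
𝟙-mono {true}  {false} b⇒c = ⊥-elim (b⇒c _)

𝟙*≤ : ∀ {b k n} → (T b → k ℕ.≤ n) → 𝟙 b ℕ.* k ℕ.≤ n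
𝟙*≤ {false}     _   = ℕ.z≤n
𝟙*≤ {true}  {k} k≤n = ℕ.≤-trans (ℕ.≤-reflexive (ℕ.*-identityˡ k)) (k≤n _)

-- Finite sums and products

∑ : List A → (A → ℕ) → ℕ
∑ []       f = 0
∑ (x ∷ xs) f = f x ℕ.+ ∑ xs f

∑-cong : ∀ (xs : List A) {f g : A → ℕ} → (∀ x → f x ≡ g x) → ∑ xs f ≡ ∑ xs g
∑-cong []       f≗g = refl
∑-cong (x ∷ xs) f≗g = cong₂ ℕ._+_ (f≗g x) (∑-cong xs f≗g)

∑-mono-≤ : ∀ (xs : List A) {f g : A → ℕ} → (∀ x → f x ℕ.≤ g x) → ∑ xs f ℕ.≤ ∑ xs g
∑-mono-≤ []       f≤g = ℕ.z≤n
∑-mono-≤ (x ∷ xs) f≤g = ℕ.+-mono-≤ (f≤g x) (∑-mono-≤ xs f≤g)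

∈⇒≤∑ : ∀ {xs : List A} {x} (f : A → ℕ) → x ∈ xs → f x ℕ.≤ ∑ xs f
∈⇒≤∑ f (here refl) = ℕ.m≤m+n _ _
∈⇒≤∑ {xs = y ∷ _} f (there x∈xs) = ℕ.≤-trans (∈⇒≤∑ f x∈xs) (ℕ.m≤n+m _ (f y))

∑-++ : ∀ (xs ys : List A) (f : A → ℕ) → ∑ (xs ++ ys) f ≡ ∑ xs f ℕ.+ ∑ ys f
∑-++ []       ys f = refl
∑-++ (x ∷ xs) ys f = trans (cong (f x ℕ.+_) (∑-++ xs ys f)) (sym (ℕ.+-assoc (f x) _ _))

∑-distrib-+ : ∀ (xs : List A) (f g : A → ℕ) → ∑ xs (λ x → f x ℕ.+ g x) ≡ ∑ xs f ℕ.+ ∑ xs g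
∑-distrib-+ []       f g = refl
∑-distrib-+ (x ∷ xs) f g =
  trans (cong (f x ℕ.+ g x ℕ.+_) (∑-distrib-+ xs f g)) (interchange (f x) (g x) _ _)

∑-distribˡ : ∀ (xs : List A) (f : A → ℕ) c → ∑ xs (λ x → c ℕ.* f x) ≡ c ℕ.* ∑ xs f
∑-distribˡ []       f c = sym (ℕ.*-zeroʳ c)
∑-distribˡ (x ∷ xs) f c =
  trans (cong (c ℕ.* f x ℕ.+_) (∑-distribˡ xs f c)) (sym (ℕ.*-distribˡ-+ c (f x) _))

∑-distribʳ : ∀ (xs : List A) (f : A → ℕ) c → ∑ xs (λ x → f x ℕ.* c) ≡ ∑ xs f ℕ.* c
∑-distribʳ []       f c = refl
∑-distribʳ (x ∷ xs) f c =
  trans (cong (f x ℕ.* c ℕ.+_) (∑-distribʳ xs f c)) (sym (ℕ.*-distribʳ-+ c (f x) _))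

∑-const : ∀ (xs : List A) c → ∑ xs (λ _ → c) ≡ length xs ℕ.* c
∑-const []       c = refl
∑-const (x ∷ xs) c = cong (c ℕ.+_) (∑-const xs c)

length≡∑1 : ∀ (xs : List A) → length xs ≡ ∑ xs (λ _ → 1)
length≡∑1 []       = refl
length≡∑1 (x ∷ xs) = cong ℕ.suc (length≡∑1 xs)

∑-map : ∀ (g : A → B) (xs : List A) (f : B → ℕ) → ∑ (map g xs) f ≡ ∑ xs (f ∘ g)
∑-map g []       f = refl
∑-map g (x ∷ xs) f = cong (f (g x) ℕ.+_) (∑-map g xs f)

∑-concatMap : ∀ (g : A → List B) (xs : List A) (f : B → ℕ) →
              ∑ (concatMap g xs) f ≡ ∑ xs (λ x → ∑ (g x) f)
∑-concatMap g []       f = refl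
∑-concatMap g (x ∷ xs) f =
  trans (∑-++ (g x) (concatMap g xs) f) (cong (∑ (g x) f ℕ.+_) (∑-concatMap g xs f))

∑-comm : ∀ (xs : List A) (ys : List B) (f : A → B → ℕ) →
         ∑ xs (λ x → ∑ ys (f x)) ≡ ∑ ys (λ y → ∑ xs (λ x → f x y))
∑-comm []       ys f = sym (∑-zero ys)
  where
  ∑-zero : ∀ (zs : List B) → ∑ zs (λ _ → 0) ≡ 0
  ∑-zero []       = refl
  ∑-zero (_ ∷ zs) = ∑-zero zs
∑-comm (x ∷ xs) ys f =
  trans (cong (∑ ys (f x) ℕ.+_) (∑-comm xs ys f)) (sym (∑-distrib-+ ys (f x) _))

∑-allFin-suc : ∀ {n} (f : Fin (ℕ.suc n) → ℕ) →
               ∑ (allFin (ℕ.suc n)) f ≡ f Fin.zero ℕ.+ ∑ (allFin n) (f ∘ Fin.suc)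
∑-allFin-suc {n} f = cong (f Fin.zero ℕ.+_) (begin
  ∑ (tabulate Fin.suc) f          ≡⟨ cong (λ xs → ∑ xs f) (sym (map-tabulate id Fin.suc)) ⟩
  ∑ (map Fin.suc (allFin n)) f    ≡⟨ ∑-map Fin.suc (allFin n) f ⟩
  ∑ (allFin n) (f ∘ Fin.suc)      ∎)
  where open ≡-Reasoning

length-filter≡∑ : ∀ {P : Pred A p} (P? : Decidable P) (xs : List A) →
                  length (filter P? xs) ≡ ∑ xs (𝟙 ∘ does ∘ P?)
length-filter≡∑ P? []       = refl
length-filter≡∑ P? (x ∷ xs) with does (P? x)
... | true  = cong ℕ.suc (length-filter≡∑ P? xs)
... | false = length-filter≡∑ P? xs

length-filterᵇ≢0⇒∃ : ∀ (q : A → Bool) (xs : List A) → length (filterᵇ q xs) ≢ 0 → ∃ (T ∘ q)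
length-filterᵇ≢0⇒∃ q xs ≢0 with filterᵇ q xs in eq
... | []    = contradiction refl ≢0
... | y ∷ _ = y , proj₂ (∈-filter⁻ (T? ∘ q) {xs = xs} (subst (y ∈_) (sym eq) (here refl)))

∣tabulate∣≡∑ : ∀ n (f : Fin n → Bool) → ∣ Vec.tabulate f ∣ ≡ ∑ (allFin n) (𝟙 ∘ f)
∣tabulate∣≡∑ ℕ.zero    f = refl
∣tabulate∣≡∑ (ℕ.suc n) f = trans (∣∷∣ (f Fin.zero) (Vec.tabulate (f ∘ Fin.suc)))
  (trans (cong (𝟙 (f Fin.zero) ℕ.+_) (∣tabulate∣≡∑ n (f ∘ Fin.suc))) (sym (∑-allFin-suc (𝟙 ∘ f))))
  where
  ∣∷∣ : ∀ {m} b (S : Subset m) → ∣ b ∷ S ∣ ≡ 𝟙 b ℕ.+ ∣ S ∣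
  ∣∷∣ true  S = refl
  ∣∷∣ false S = refl

∏ : ∀ {j} → (A → ℕ) → Vec A j → ℕ
∏ f []       = 1
∏ f (v ∷ vs) = f v ℕ.* ∏ f vs

∏𝟙≤1 : ∀ {j} (q : A → Bool) (vs : Vec A j) → ∏ (𝟙 ∘ q) vs ℕ.≤ 1
∏𝟙≤1 q []       = ℕ.≤-refl
∏𝟙≤1 q (v ∷ vs) = ℕ.*-mono-≤ (𝟙≤1 (q v)) (∏𝟙≤1 q vs)

∏𝟙≤𝟙 : ∀ {j} (q : A → Bool) {vs : Vec A j} {v} → v ∈ᵛ vs → ∏ (𝟙 ∘ q) vs ℕ.≤ 𝟙 (q v)
∏𝟙≤𝟙 q {v ∷ vs} (Anyᵛ.here refl) =
  ℕ.≤-trans (ℕ.*-monoʳ-≤ (𝟙 (q v)) (∏𝟙≤1 q vs)) (ℕ.≤-reflexive (ℕ.*-identityʳ _))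
∏𝟙≤𝟙 q {w ∷ vs} (Anyᵛ.there v∈vs) =
  ℕ.≤-trans (ℕ.*-monoˡ-≤ (∏ (𝟙 ∘ q) vs) (𝟙≤1 (q w)))
            (ℕ.≤-trans (ℕ.≤-reflexive (ℕ.*-identityˡ _)) (∏𝟙≤𝟙 q v∈vs))

∑-tuples-suc : ∀ n q (f : Vec (Fin n) (ℕ.suc q) → ℕ) →
               ∑ (tuples n (ℕ.suc q)) f ≡ ∑ (allFin n) (λ i → ∑ (tuples n q) (λ r → f (i ∷ r)))
∑-tuples-suc n q f = trans (∑-concatMap (λ i → map (i ∷_) (tuples n q)) (allFin n) f)
                           (∑-cong (allFin n) (λ i → ∑-map (i ∷_) (tuples n q) f))

∈-tuples : ∀ {n q} (r : Vec (Fin n) q) → r ∈ tuples n q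
∈-tuples []      = here refl
∈-tuples (i ∷ r) = ∈-concatMap⁺ _ (lose (∈-allFin i) (∈-map⁺ (i ∷_) (∈-tuples r)))

length-tuples : ∀ n q → length (tuples n q) ≡ n ℕ.^ q
length-tuples n ℕ.zero    = refl
length-tuples n (ℕ.suc q) = begin
  length (tuples n (ℕ.suc q))                    ≡⟨ length≡∑1 (tuples n (ℕ.suc q)) ⟩
  ∑ (tuples n (ℕ.suc q)) (λ _ → 1)               ≡⟨ ∑-tuples-suc n q (λ _ → 1) ⟩
  ∑ (allFin n) (λ _ → ∑ (tuples n q) (λ _ → 1))  ≡⟨ ∑-cong (allFin n) (λ _ → sym (length≡∑1 (tuples n q))) ⟩
  ∑ (allFin n) (λ _ → length (tuples n q))       ≡⟨ ∑-cong (allFin n) (λ _ → length-tuples n q) ⟩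
  ∑ (allFin n) (λ _ → n ℕ.^ q)                   ≡⟨ ∑-const (allFin n) (n ℕ.^ q) ⟩
  length (allFin n) ℕ.* n ℕ.^ q                  ≡⟨ cong (ℕ._* n ℕ.^ q) (length-tabulate {n = n} id) ⟩
  n ℕ.* n ℕ.^ q                                  ∎
  where open ≡-Reasoning

∑^≡∑∏ : ∀ n j (f : Fin n → ℕ) → ∑ (allFin n) f ℕ.^ j ≡ ∑ (tuples n j) (∏ f)
∑^≡∑∏ n ℕ.zero    f = refl
∑^≡∑∏ n (ℕ.suc j) f = begin
  ∑ (allFin n) f ℕ.* ∑ (allFin n) f ℕ.^ j                    ≡⟨ cong (∑ (allFin n) f ℕ.*_) (∑^≡∑∏ n j f) ⟩
  ∑ (allFin n) f ℕ.* ∑ (tuples n j) (∏ f)                    ≡⟨ sym (∑-distribʳ (allFin n) f _) ⟩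
  ∑ (allFin n) (λ i → f i ℕ.* ∑ (tuples n j) (∏ f))
    ≡⟨ ∑-cong (allFin n) (λ i → sym (∑-distribˡ (tuples n j) (∏ f) (f i))) ⟩
  ∑ (allFin n) (λ i → ∑ (tuples n j) (λ r → f i ℕ.* ∏ f r))  ≡⟨ sym (∑-tuples-suc n j (∏ f)) ⟩
  ∑ (tuples n (ℕ.suc j)) (∏ f)                               ∎
  where open ≡-Reasoning

∑-downFrom-<ᵇ : ∀ h a → ∑ (downFrom h) (λ s → 𝟙 (s ℕ.<ᵇ a)) ≡ h ℕ.⊓ a
∑-downFrom-<ᵇ ℕ.zero    a = refl
∑-downFrom-<ᵇ (ℕ.suc h) a with h ℕ.<ᵇ a | ℕ.<ᵇ-reflects-< h a
... | true  | ofʸ h<a = trans (cong ℕ.suc (trans (∑-downFrom-<ᵇ h a) (ℕ.m≤n⇒m⊓n≡m (ℕ.<⇒≤ h<a))))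
                              (sym (ℕ.m≤n⇒m⊓n≡m h<a))
... | false | ofⁿ h≮a = trans (trans (∑-downFrom-<ᵇ h a) (ℕ.m≥n⇒m⊓n≡n a≤h))
                              (sym (ℕ.m≥n⇒m⊓n≡n (ℕ.m≤n⇒m≤1+n a≤h)))
  where a≤h = ℕ.≮⇒≥ h≮a

layer-cake : ∀ (xs : List A) (f : A → ℕ) h → (∀ x → f x ℕ.≤ h) →
             ∑ xs f ≡ ∑ (downFrom h) (λ s → ∑ xs (λ x → 𝟙 (s ℕ.<ᵇ f x)))
layer-cake xs f h f≤h = trans
  (∑-cong xs (λ x → sym (trans (∑-downFrom-<ᵇ h (f x)) (ℕ.m≥n⇒m⊓n≡n (f≤h x)))))
  (∑-comm xs (downFrom h) (λ x s → 𝟙 (s ℕ.<ᵇ f x)))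

ℚ-ring : AlmostCommutativeRing _ _
ℚ-ring = fromCommutativeRing ℚ.+-*-commutativeRing (λ x → dec⇒maybe (0ℚ ℚ.≟ x))

ℕ→ℚ≡mkℚ : ∀ n → ℕ→ℚ n ≡ ℚ.mkℚ (+ n) 0 (Coprime.sym (1-coprimeTo n))
ℕ→ℚ≡mkℚ n = ℚ.normalize-coprime (Coprime.sym (1-coprimeTo n))

ℕ→ℚ-homo-+ : ∀ m n → ℕ→ℚ (m ℕ.+ n) ≡ ℕ→ℚ m + ℕ→ℚ n
ℕ→ℚ-homo-+ m n = trans
  (cong (ℚ._/ 1) (sym (cong₂ ℤ._+_ (ℤ.*-identityʳ (+ m)) (ℤ.*-identityʳ (+ n)))))
  (sym (cong₂ _+_ (ℕ→ℚ≡mkℚ m) (ℕ→ℚ≡mkℚ n)))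

ℕ→ℚ-homo-* : ∀ m n → ℕ→ℚ (m ℕ.* n) ≡ ℕ→ℚ m * ℕ→ℚ n
ℕ→ℚ-homo-* m n = trans (cong (ℚ._/ 1) (ℤ.pos-* m n)) (sym (cong₂ _*_ (ℕ→ℚ≡mkℚ m) (ℕ→ℚ≡mkℚ n)))

ℕ→ℚ-homo-^ : ∀ m k → ℕ→ℚ (m ℕ.^ k) ≡ ℕ→ℚ m ^ℚ k
ℕ→ℚ-homo-^ m ℕ.zero    = refl
ℕ→ℚ-homo-^ m (ℕ.suc k) = trans (ℕ→ℚ-homo-* m (m ℕ.^ k)) (cong (ℕ→ℚ m *_) (ℕ→ℚ-homo-^ m k))

ℕ→ℚ-mono-≤ : ∀ {m n} → m ℕ.≤ n → ℕ→ℚ m ≤ ℕ→ℚ n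
ℕ→ℚ-mono-≤ {m} {n} m≤n rewrite ℕ→ℚ≡mkℚ m | ℕ→ℚ≡mkℚ n =
  ℚ.*≤* (subst₂ ℤ._≤_ (sym (ℤ.*-identityʳ (+ m))) (sym (ℤ.*-identityʳ (+ n))) (ℤ.+≤+ m≤n))

ℕ→ℚ-nonNeg : ∀ n → 0ℚ ≤ ℕ→ℚ n
ℕ→ℚ-nonNeg n = ℕ→ℚ-mono-≤ (ℕ.z≤n {n})

ℕ→ℚ-pos : ∀ n .{{_ : NonZero n}} → 0ℚ < ℕ→ℚ n
ℕ→ℚ-pos n = ℚ.positive⁻¹ (ℕ→ℚ n) {{ℚ.normalize-pos n 1}}

[m/n]*n≡m : ∀ m n .{{_ : NonZero n}} → (+ m ℚ./ n) * ℕ→ℚ n ≡ ℕ→ℚ m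
[m/n]*n≡m m n@(ℕ.suc k) = ℚ.toℚᵘ-injective (begin
  ℚ.toℚᵘ ((+ m ℚ./ n) * ℕ→ℚ n)            ≈⟨ ℚ.toℚᵘ-homo-* (+ m ℚ./ n) (ℕ→ℚ n) ⟩
  ℚ.toℚᵘ (+ m ℚ./ n) ℚᵘ.* ℚ.toℚᵘ (ℕ→ℚ n)  ≈⟨ ℚᵘ.*-cong (ℚ.toℚᵘ-fromℚᵘ (ℚᵘ.mkℚᵘ (+ m) k))
                                                         (ℚ.toℚᵘ-fromℚᵘ (ℚᵘ.mkℚᵘ (+ n) 0)) ⟩
  ℚᵘ.mkℚᵘ (+ m) k ℚᵘ.* ℚᵘ.mkℚᵘ (+ n) 0    ≈⟨ ℚᵘ.*≡* cross ⟩
  ℚᵘ.mkℚᵘ (+ m) 0                         ≈⟨ ℚᵘ.≃-sym (ℚ.toℚᵘ-fromℚᵘ (ℚᵘ.mkℚᵘ (+ m) 0)) ⟩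
  ℚ.toℚᵘ (ℕ→ℚ m)                          ∎)
  where
  open ℚᵘ.≃-Reasoning
  cross : (+ m ℤ.* + n) ℤ.* + 1 ≡ + m ℤ.* + (n ℕ.* 1)
  cross = trans (ℤ.*-identityʳ _) (cong (λ z → + m ℤ.* + z) (sym (ℕ.*-identityʳ n)))

*-nonNeg : ∀ {x y} → 0ℚ ≤ x → 0ℚ ≤ y → 0ℚ ≤ x * y
*-nonNeg {x} {y} 0≤x 0≤y =
  ℚ.nonNegative⁻¹ (x * y) {{ℚ.nonNeg*nonNeg⇒nonNeg x {{ℚ.nonNegative 0≤x}} y {{ℚ.nonNegative 0≤y}}}}

*-monoˡ-≤-nonNeg : ∀ {r x y} → 0ℚ ≤ r → x ≤ y → r * x ≤ r * y
*-monoˡ-≤-nonNeg {r} 0≤r = ℚ.*-monoˡ-≤-nonNeg r {{ℚ.nonNegative 0≤r}}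

*-monoʳ-≤-nonNeg : ∀ {r x y} → 0ℚ ≤ r → x ≤ y → x * r ≤ y * r
*-monoʳ-≤-nonNeg {r} 0≤r = ℚ.*-monoʳ-≤-nonNeg r {{ℚ.nonNegative 0≤r}}

*-mono-≤-nonNeg : ∀ {w x y z} → 0ℚ ≤ w → 0ℚ ≤ z → w ≤ x → y ≤ z → w * y ≤ x * z
*-mono-≤-nonNeg 0≤w 0≤z w≤x y≤z = ℚ.≤-trans (*-monoˡ-≤-nonNeg 0≤w y≤z) (*-monoʳ-≤-nonNeg 0≤z w≤x)

0≤1-x : ∀ {x} → x ≤ 1ℚ → 0ℚ ≤ 1ℚ - x
0≤1-x {x} x≤1 = subst (_≤ 1ℚ - x) (ℚ.+-inverseʳ x) (ℚ.+-monoˡ-≤ (ℚ.- x) x≤1)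

1-x≤1 : ∀ {x} → 0ℚ ≤ x → 1ℚ - x ≤ 1ℚ
1-x≤1 0≤x = ℚ.+-monoʳ-≤ 1ℚ (ℚ.neg-antimono-≤ 0≤x)

^ℚ-nonNeg : ∀ {x} k → 0ℚ ≤ x → 0ℚ ≤ x ^ℚ k
^ℚ-nonNeg ℕ.zero    0≤x = ℕ→ℚ-nonNeg 1
^ℚ-nonNeg (ℕ.suc k) 0≤x = *-nonNeg 0≤x (^ℚ-nonNeg k 0≤x)

^ℚ-pos : ∀ {x} k → 0ℚ < x → 0ℚ < x ^ℚ k
^ℚ-pos ℕ.zero        0<x = ℕ→ℚ-pos 1
^ℚ-pos {x} (ℕ.suc k) 0<x = ℚ.positive⁻¹ _
  {{ℚ.pos*pos⇒pos x {{ℚ.positive 0<x}} (x ^ℚ k) {{ℚ.positive (^ℚ-pos k 0<x)}}}}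

^ℚ-monoˡ-≤ : ∀ {x y} k → 0ℚ ≤ x → x ≤ y → x ^ℚ k ≤ y ^ℚ k
^ℚ-monoˡ-≤ ℕ.zero    0≤x x≤y = ℚ.≤-refl
^ℚ-monoˡ-≤ (ℕ.suc k) 0≤x x≤y =
  *-mono-≤-nonNeg 0≤x (^ℚ-nonNeg k (ℚ.≤-trans 0≤x x≤y)) x≤y (^ℚ-monoˡ-≤ k 0≤x x≤y)

^ℚ-monoˡ-< : ∀ {x y} k → 0ℚ ≤ x → x < y → x ^ℚ ℕ.suc k < y ^ℚ ℕ.suc k
^ℚ-monoˡ-< {x} {y} k 0≤x x<y = ℚ.≤-<-trans
  (*-monoˡ-≤-nonNeg 0≤x (^ℚ-monoˡ-≤ k 0≤x (ℚ.<⇒≤ x<y)))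
  (ℚ.*-monoˡ-<-pos (y ^ℚ k) {{ℚ.positive (^ℚ-pos k (ℚ.≤-<-trans 0≤x x<y))}} x<y)

^ℚ-cancelˡ-≤ : ∀ {x y} k → 0ℚ ≤ y → x ^ℚ ℕ.suc k ≤ y ^ℚ ℕ.suc k → x ≤ y
^ℚ-cancelˡ-≤ {x} {y} k 0≤y xᵏ≤yᵏ with x ℚ.≤? y
... | yes x≤y = x≤y
... | no  x≰y = contradiction (ℚ.<-≤-trans (^ℚ-monoˡ-< k 0≤y (ℚ.≰⇒> x≰y)) xᵏ≤yᵏ) (ℚ.<-irrefl refl)

^ℚ-cancelˡ-< : ∀ {x y} k → 0ℚ ≤ y → x ^ℚ k < y ^ℚ k → x < y
^ℚ-cancelˡ-< {x} {y} k 0≤y xᵏ<yᵏ with x ℚ.<? y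
... | yes x<y = x<y
... | no  x≮y = contradiction (ℚ.<-≤-trans xᵏ<yᵏ (^ℚ-monoˡ-≤ k 0≤y (ℚ.≮⇒≥ x≮y))) (ℚ.<-irrefl refl)

^ℚ-distribʳ-* : ∀ x y k → (x * y) ^ℚ k ≡ x ^ℚ k * y ^ℚ k
^ℚ-distribʳ-* x y ℕ.zero    = refl
^ℚ-distribʳ-* x y (ℕ.suc k) = trans (cong ((x * y) *_) (^ℚ-distribʳ-* x y k)) (interchange-* x y _ _)
  where
  interchange-* : ∀ w x y z → w * x * (y * z) ≡ w * y * (x * z)
  interchange-* = solve-∀ ℚ-ring

1^ℚ : ∀ k → 1ℚ ^ℚ k ≡ 1ℚ
1^ℚ ℕ.zero    = refl
1^ℚ (ℕ.suc k) = cong (1ℚ *_) (1^ℚ k)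

∑-affine-bound : ∀ (xs : List A) {f g : A → ℕ} {α γ κ : ℚ} →
                 (∀ x → α * ℕ→ℚ (f x) ≤ γ * ℕ→ℚ (g x) + κ) →
                 α * ℕ→ℚ (∑ xs f) ≤ γ * ℕ→ℚ (∑ xs g) + ℕ→ℚ (length xs) * κ
∑-affine-bound []       {α = α} {γ} {κ} _ = ℚ.≤-reflexive (vanish α γ κ)
  where
  vanish : ∀ α γ κ → α * 0ℚ ≡ γ * 0ℚ + 0ℚ * κ
  vanish = solve-∀ ℚ-ring
∑-affine-bound (x ∷ xs) {f} {g} {α} {γ} {κ} bound = begin
  α * ℕ→ℚ (f x ℕ.+ ∑ xs f)
    ≡⟨ cong (α *_) (ℕ→ℚ-homo-+ (f x) (∑ xs f)) ⟩
  α * (ℕ→ℚ (f x) + ℕ→ℚ (∑ xs f))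
    ≡⟨ ℚ.*-distribˡ-+ α (ℕ→ℚ (f x)) (ℕ→ℚ (∑ xs f)) ⟩
  α * ℕ→ℚ (f x) + α * ℕ→ℚ (∑ xs f)
    ≤⟨ ℚ.+-mono-≤ (bound x) (∑-affine-bound xs {f} {g} {α} {γ} {κ} bound) ⟩
  (γ * ℕ→ℚ (g x) + κ) + (γ * ℕ→ℚ (∑ xs g) + ℕ→ℚ (length xs) * κ)
    ≡⟨ regroup γ (ℕ→ℚ (g x)) (ℕ→ℚ (∑ xs g)) (ℕ→ℚ (length xs)) κ ⟩
  γ * (ℕ→ℚ (g x) + ℕ→ℚ (∑ xs g)) + (1ℚ + ℕ→ℚ (length xs)) * κ
    ≡⟨ sym (cong₂ (λ u v → γ * u + v * κ) (ℕ→ℚ-homo-+ (g x) (∑ xs g)) (ℕ→ℚ-homo-+ 1 (length xs))) ⟩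
  γ * ℕ→ℚ (g x ℕ.+ ∑ xs g) + ℕ→ℚ (ℕ.suc (length xs)) * κ ∎
  where
  open ℚ.≤-Reasoning
  regroup : ∀ γ u v n κ → (γ * u + κ) + (γ * v + n * κ) ≡ γ * (u + v) + (1ℚ + n) * κ
  regroup = solve-∀ ℚ-ring

∑-linear-bound : ∀ (xs : List A) {f g : A → ℕ} {α γ : ℚ} →
                 (∀ x → α * ℕ→ℚ (f x) ≤ γ * ℕ→ℚ (g x)) →
                 α * ℕ→ℚ (∑ xs f) ≤ γ * ℕ→ℚ (∑ xs g)
∑-linear-bound xs {f} {g} {α} {γ} bound = subst (α * ℕ→ℚ (∑ xs f) ≤_) drop-zero
  (∑-affine-bound xs {f} {g} {α} {γ} {0ℚ} (λ x → subst (α * ℕ→ℚ (f x) ≤_) (sym (ℚ.+-identityʳ _)) (bound x)))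
  where
  drop-zero : γ * ℕ→ℚ (∑ xs g) + ℕ→ℚ (length xs) * 0ℚ ≡ γ * ℕ→ℚ (∑ xs g)
  drop-zero = trans (cong (λ u → γ * ℕ→ℚ (∑ xs g) + u) (ℚ.*-zeroʳ (ℕ→ℚ (length xs)))) (ℚ.+-identityʳ _)

^ℚ-≤-∏ : ∀ {j} e {Y z : ℚ} (f : A → ℕ) (vs : Vec A j) → 0ℚ ≤ Y → 0ℚ ≤ z →
         (∀ {v} → v ∈ᵛ vs → z ≤ Y * ℕ→ℚ (f v) ^ℚ e) → z ^ℚ j ≤ Y ^ℚ j * ℕ→ℚ (∏ f vs) ^ℚ e
^ℚ-≤-∏ e f []       0≤Y 0≤z z≤ = ℚ.≤-reflexive (sym (trans (ℚ.*-identityˡ _) (1^ℚ e)))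
^ℚ-≤-∏ {j = ℕ.suc j} e {Y} {z} f (v ∷ vs) 0≤Y 0≤z z≤ = begin
  z * z ^ℚ j
    ≤⟨ *-mono-≤-nonNeg 0≤z (*-nonNeg (^ℚ-nonNeg j 0≤Y) (^ℚ-nonNeg e (ℕ→ℚ-nonNeg (∏ f vs))))
                       (z≤ (Anyᵛ.here refl)) (^ℚ-≤-∏ e f vs 0≤Y 0≤z (z≤ ∘ Anyᵛ.there)) ⟩
  (Y * ℕ→ℚ (f v) ^ℚ e) * (Y ^ℚ j * ℕ→ℚ (∏ f vs) ^ℚ e)
    ≡⟨ interchange-* Y _ _ _ ⟩
  (Y * Y ^ℚ j) * (ℕ→ℚ (f v) ^ℚ e * ℕ→ℚ (∏ f vs) ^ℚ e)
    ≡⟨ cong (Y * Y ^ℚ j *_) (sym (^ℚ-distribʳ-* (ℕ→ℚ (f v)) (ℕ→ℚ (∏ f vs)) e)) ⟩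
  (Y * Y ^ℚ j) * (ℕ→ℚ (f v) * ℕ→ℚ (∏ f vs)) ^ℚ e
    ≡⟨ cong (λ u → (Y * Y ^ℚ j) * u ^ℚ e) (sym (ℕ→ℚ-homo-* (f v) (∏ f vs))) ⟩
  (Y * Y ^ℚ j) * ℕ→ℚ (f v ℕ.* ∏ f vs) ^ℚ e ∎
  where
  open ℚ.≤-Reasoning
  interchange-* : ∀ w x y z → (w * x) * (y * z) ≡ (w * y) * (x * z)
  interchange-* = solve-∀ ℚ-ring

≤-*∏-from-≤-*^ : ∀ {d} {Y z : ℚ} (f : A → ℕ) (vs : Vec A (ℕ.suc d)) → 0ℚ ≤ Y → 0ℚ ≤ z →
                 (∀ {v} → v ∈ᵛ vs → z ≤ Y * ℕ→ℚ (f v) ^ℚ ℕ.suc d) → z ≤ Y * ℕ→ℚ (∏ f vs)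
≤-*∏-from-≤-*^ {d = d} {Y} f vs 0≤Y 0≤z z≤ = ^ℚ-cancelˡ-≤ d (*-nonNeg 0≤Y (ℕ→ℚ-nonNeg (∏ f vs)))
  (subst (_ ≤_) (sym (^ℚ-distribʳ-* Y (ℕ→ℚ (∏ f vs)) (ℕ.suc d))) (^ℚ-≤-∏ (ℕ.suc d) f vs 0≤Y 0≤z z≤))

-- Legal tuple sets, slices and links

Legal : ∀ {M q} (t : ℕ) .{{_ : NonZero t}} → TupleSet M q → Set
Legal {M} {q} t E = ∀ (ℓ : Fin q) (e : Vec (Fin M) q) → lineCount E ℓ e ≡ 0 ⊎ M / t ℕ.≤ lineCount E ℓ e

slice : ∀ {M q} → TupleSet M (ℕ.suc q) → Fin M → TupleSet M q
slice E e r = E (e ∷ r)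

link : ∀ {M N q} → IndicatorMatrix M N → TupleSet M (ℕ.suc q) → Fin N → TupleSet M q
link {M} P E v r = any (λ e → E (e ∷ r) ∧ lookup (P e) v) (allFin M)

module _ {M : ℕ} where

  cardT≡∑ : ∀ {q} (E : TupleSet M q) → cardT E ≡ ∑ (tuples M q) (𝟙 ∘ E)
  cardT≡∑ {q} E = length-filter≡∑ (T? ∘ E) (tuples M q)

  lineCount≡∑ : ∀ {q} (E : TupleSet M q) ℓ e → lineCount E ℓ e ≡ ∑ (allFin M) (λ x → 𝟙 (E (e [ ℓ ]≔ x)))
  lineCount≡∑ E ℓ e = length-filter≡∑ (λ x → T? (E (e [ ℓ ]≔ x))) (allFin M)

  cardT≤M^q : ∀ {q} (E : TupleSet M q) → cardT E ℕ.≤ M ℕ.^ q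
  cardT≤M^q {q} E = begin
    cardT E                   ≡⟨ cardT≡∑ E ⟩
    ∑ (tuples M q) (𝟙 ∘ E)    ≤⟨ ∑-mono-≤ (tuples M q) (𝟙≤1 ∘ E) ⟩
    ∑ (tuples M q) (λ _ → 1)  ≡⟨ sym (length≡∑1 (tuples M q)) ⟩
    length (tuples M q)       ≡⟨ length-tuples M q ⟩
    M ℕ.^ q                   ∎
    where open ℕ.≤-Reasoning

  cardT≡∑slices : ∀ {q} (E : TupleSet M (ℕ.suc q)) → cardT E ≡ ∑ (allFin M) (cardT ∘ slice E)
  cardT≡∑slices {q} E = trans (cardT≡∑ E) (trans (∑-tuples-suc M q (𝟙 ∘ E))
    (∑-cong (allFin M) (λ e → sym (cardT≡∑ (slice E e)))))

  1≤lineCount : ∀ {q} (E : TupleSet M q) ℓ {e} → T (E e) → 1 ℕ.≤ lineCount E ℓ e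
  1≤lineCount E ℓ {e} Ee = begin
    1                                        ≡⟨ sym (T⇒𝟙≡1 (subst (T ∘ E) (sym (Vec.[]≔-lookup e ℓ)) Ee)) ⟩
    𝟙 (E (e [ ℓ ]≔ lookup e ℓ))
      ≤⟨ ∈⇒≤∑ (λ x → 𝟙 (E (e [ ℓ ]≔ x))) (∈-allFin (lookup e ℓ)) ⟩
    ∑ (allFin M) (λ x → 𝟙 (E (e [ ℓ ]≔ x)))  ≡⟨ sym (lineCount≡∑ E ℓ e) ⟩
    lineCount E ℓ e                          ∎
    where open ℕ.≤-Reasoning

  legal⇒M/t≤lineCount : ∀ {q t} .{{_ : NonZero t}} (E : TupleSet M q) → Legal t E →
               ∀ ℓ e → T (E e) → M / t ℕ.≤ lineCount E ℓ e
  legal⇒M/t≤lineCount E legal ℓ e Ee with legal ℓ e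
  ... | inj₁ empty = contradiction (subst (1 ℕ.≤_) empty (1≤lineCount E ℓ Ee)) λ ()
  ... | inj₂ large = large

module _ {M N : ℕ} (P : IndicatorMatrix M N) {q : ℕ} (E : TupleSet M (ℕ.suc q)) where

  T-link⁺ : ∀ {e v r} → T (E (e ∷ r)) → T (lookup (P e) v) → T (link P E v r)
  T-link⁺ {e} Eer ve = T-any⁺ _ (∈-allFin e) (T-∧⁺ Eer ve)

  T-link⁻ : ∀ {v r} → T (link P E v r) → ∃ λ e → T (E (e ∷ r)) × T (lookup (P e) v)
  T-link⁻ Lr with e , Eer∧ve ← T-any⁻ _ (allFin M) Lr = e , T-∧⁻ Eer∧ve

  inNbrSet-∷ : ∀ v w → inNbrSet P E (v ∷ w) ≡ inNbrSet P (link P E v) w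
  inNbrSet-∷ v w = T-injective into outof
    where
    into : T (inNbrSet P E (v ∷ w)) → T (inNbrSet P (link P E v) w)
    into h with i ∷ r , h′ ← T-any⁻ _ (tuples M (ℕ.suc q)) h =
      let (Eir , vi∧rw) = T-∧⁻ h′
          (vi , rw)     = T-∧⁻ vi∧rw
      in T-any⁺ _ (∈-tuples r) (T-∧⁺ (T-link⁺ Eir vi) rw)
    outof : T (inNbrSet P (link P E v) w) → T (inNbrSet P E (v ∷ w))
    outof h with r , h′ ← T-any⁻ _ (tuples M q) h =
      let (Lr , rw)      = T-∧⁻ h′
          (i , Eir , vi) = T-link⁻ Lr
      in T-any⁺ _ (∈-tuples (i ∷ r)) (T-∧⁺ Eir (T-∧⁺ vi rw))

  nbrCard≡∑links : nbrCard P E ≡ ∑ (allFin N) (nbrCard P ∘ link P E)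
  nbrCard≡∑links = begin
    nbrCard P E
      ≡⟨ length-filter≡∑ (T? ∘ inNbrSet P E) (tuples N (ℕ.suc q)) ⟩
    ∑ (tuples N (ℕ.suc q)) (𝟙 ∘ inNbrSet P E)
      ≡⟨ ∑-tuples-suc N q (𝟙 ∘ inNbrSet P E) ⟩
    ∑ (allFin N) (λ v → ∑ (tuples N q) (λ w → 𝟙 (inNbrSet P E (v ∷ w))))
      ≡⟨ ∑-cong (allFin N) (λ v → ∑-cong (tuples N q) (λ w → cong 𝟙 (inNbrSet-∷ v w))) ⟩
    ∑ (allFin N) (λ v → ∑ (tuples N q) (𝟙 ∘ inNbrSet P (link P E v)))
      ≡⟨ ∑-cong (allFin N) (λ v → sym (length-filter≡∑ (T? ∘ inNbrSet P (link P E v)) (tuples N q))) ⟩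
    ∑ (allFin N) (nbrCard P ∘ link P E) ∎
    where open ≡-Reasoning

  cardT-slice≤cardT-link : ∀ {e v} → T (lookup (P e) v) → cardT (slice E e) ℕ.≤ cardT (link P E v)
  cardT-slice≤cardT-link {e} {v} ve = subst₂ ℕ._≤_ (sym (cardT≡∑ (slice E e))) (sym (cardT≡∑ (link P E v)))
    (∑-mono-≤ (tuples M q) (λ r → 𝟙-mono (λ Eer → T-link⁺ Eer ve)))

  legal-link : ∀ {t} .{{_ : NonZero t}} → Legal t E → ∀ v → Legal t (link P E v)
  legal-link {t} legal v ℓ r with lineCount (link P E v) ℓ r ℕ.≟ 0
  ... | yes empty    = inj₁ empty
  ... | no  nonempty with x , Lr′ ← length-filterᵇ≢0⇒∃ _ (allFin M) nonempty
                     with i , Eir′ , vi ← T-link⁻ Lr′ = inj₂ (begin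
    M / t                                             ≤⟨ legal⇒M/t≤lineCount E legal (Fin.suc ℓ) (i ∷ r′) Eir′ ⟩
    lineCount E (Fin.suc ℓ) (i ∷ r′)                  ≡⟨ lineCount≡∑ E (Fin.suc ℓ) (i ∷ r′) ⟩
    ∑ (allFin M) (λ y → 𝟙 (E (i ∷ (r′ [ ℓ ]≔ y))))    ≤⟨ ∑-mono-≤ (allFin M) (λ y → 𝟙-mono (into-link y)) ⟩
    ∑ (allFin M) (λ y → 𝟙 (link P E v (r [ ℓ ]≔ y)))  ≡⟨ sym (lineCount≡∑ (link P E v) ℓ r) ⟩
    lineCount (link P E v) ℓ r                        ∎)
    where
    open ℕ.≤-Reasoning
    r′ = r [ ℓ ]≔ x
    into-link : ∀ y → T (E (i ∷ (r′ [ ℓ ]≔ y))) → T (link P E v (r [ ℓ ]≔ y))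
    into-link y Eir′y = T-link⁺ (subst (λ s → T (E (i ∷ s))) (Vec.[]≔-idempotent r ℓ) Eir′y) vi

module _ {M q : ℕ} (E : TupleSet M (ℕ.suc q)) where

  slice*[M/t]≤cardT : ∀ {t} .{{_ : NonZero t}} → Legal t E → ∀ e → cardT (slice E e) ℕ.* (M / t) ℕ.≤ cardT E
  slice*[M/t]≤cardT {t} legal e = begin
    cardT (slice E e) ℕ.* (M / t)
      ≡⟨ cong (ℕ._* (M / t)) (cardT≡∑ (slice E e)) ⟩
    ∑ (tuples M q) (𝟙 ∘ slice E e) ℕ.* (M / t)
      ≡⟨ sym (∑-distribʳ (tuples M q) (𝟙 ∘ slice E e) (M / t)) ⟩
    ∑ (tuples M q) (λ r → 𝟙 (E (e ∷ r)) ℕ.* (M / t))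
      ≤⟨ ∑-mono-≤ (tuples M q) (λ r → 𝟙*≤ (legal⇒M/t≤lineCount E legal Fin.zero (e ∷ r))) ⟩
    ∑ (tuples M q) (λ r → lineCount E Fin.zero (e ∷ r))
      ≡⟨ ∑-cong (tuples M q) (λ r → lineCount≡∑ E Fin.zero (e ∷ r)) ⟩
    ∑ (tuples M q) (λ r → ∑ (allFin M) (λ i → 𝟙 (E (i ∷ r))))
      ≡⟨ sym (∑-comm (allFin M) (tuples M q) (λ i r → 𝟙 (E (i ∷ r)))) ⟩
    ∑ (allFin M) (λ i → ∑ (tuples M q) (𝟙 ∘ slice E i))
      ≡⟨ sym (trans (cardT≡∑slices E) (∑-cong (allFin M) (cardT≡∑ ∘ slice E))) ⟩
    cardT E ∎
    where open ℕ.≤-Reasoning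

  maxSlice : ℕ
  maxSlice = max 0 (map (cardT ∘ slice E) (allFin M))

  slice≤maxSlice : ∀ e → cardT (slice E e) ℕ.≤ maxSlice
  slice≤maxSlice e = v≤max⁺ 0 _ (inj₂ (lose (∈-map⁺ (cardT ∘ slice E) (∈-allFin e)) ℕ.≤-refl))

  maxSlice*[M/t]≤cardT : ∀ {t} .{{_ : NonZero t}} → Legal t E → maxSlice ℕ.* (M / t) ℕ.≤ cardT E
  maxSlice*[M/t]≤cardT {t} legal with argmax-sel id 0 (map (cardT ∘ slice E) (allFin M))
  ... | inj₁ max≡0 = subst (λ h → h ℕ.* (M / t) ℕ.≤ cardT E) (sym max≡0) ℕ.z≤n
  ... | inj₂ max∈  with e , _ , max≡ ← ∈-map⁻ (cardT ∘ slice E) max∈ =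
    subst (λ h → h ℕ.* (M / t) ℕ.≤ cardT E) (sym max≡) (slice*[M/t]≤cardT legal e)

-- Sparse hypergraphs

Sparse : ∀ {M N} .{{_ : NonZero N}} → ℕ → ℚ → IndicatorMatrix M N → Set
Sparse {M} {N} d β P = ∀ (V' : Subset N) →
  ℕ→ℚ (containedCount P V') ≤ ((+ ∣ V' ∣ ℚ./ N) ^ℚ d) * ℕ→ℚ M + β * ℕ→ℚ M

sparse-cleared : ∀ {M N} .{{_ : NonZero N}} {d β} (P : IndicatorMatrix M N) → Sparse d β P → ∀ V' →
                 ℕ→ℚ N ^ℚ d * ℕ→ℚ (containedCount P V')
                   ≤ ℕ→ℚ M * ℕ→ℚ (∣ V' ∣ ℕ.^ d) + β * ℕ→ℚ M * ℕ→ℚ N ^ℚ d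
sparse-cleared {M} {N} {d} {β} P sparse V' = begin
  Nᵈ * ℕ→ℚ (containedCount P V')          ≤⟨ *-monoˡ-≤-nonNeg (^ℚ-nonNeg d (ℕ→ℚ-nonNeg N)) (sparse V') ⟩
  Nᵈ * (ρ ^ℚ d * ℕ→ℚ M + β * ℕ→ℚ M)       ≡⟨ expand Nᵈ (ρ ^ℚ d) (ℕ→ℚ M) β ⟩
  ℕ→ℚ M * (ρ ^ℚ d * Nᵈ) + β * ℕ→ℚ M * Nᵈ  ≡⟨ cong (λ x → ℕ→ℚ M * x + β * ℕ→ℚ M * Nᵈ) ρᵈNᵈ ⟩
  ℕ→ℚ M * ℕ→ℚ (∣ V' ∣ ℕ.^ d) + β * ℕ→ℚ M * Nᵈ ∎
  where
  open ℚ.≤-Reasoning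
  Nᵈ = ℕ→ℚ N ^ℚ d
  ρ  = + ∣ V' ∣ ℚ./ N
  expand : ∀ n r m b → n * (r * m + b * m) ≡ m * (r * n) + b * m * n
  expand = solve-∀ ℚ-ring
  ρᵈNᵈ : ρ ^ℚ d * Nᵈ ≡ ℕ→ℚ (∣ V' ∣ ℕ.^ d)
  ρᵈNᵈ = begin-equality
    ρ ^ℚ d * Nᵈ         ≡⟨ sym (^ℚ-distribʳ-* ρ (ℕ→ℚ N) d) ⟩
    (ρ * ℕ→ℚ N) ^ℚ d    ≡⟨ cong (_^ℚ d) ([m/n]*n≡m ∣ V' ∣ N) ⟩
    ℕ→ℚ ∣ V' ∣ ^ℚ d     ≡⟨ sym (ℕ→ℚ-homo-^ ∣ V' ∣ d) ⟩
    ℕ→ℚ (∣ V' ∣ ℕ.^ d)  ∎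

superlevel : ∀ {N} → (Fin N → ℕ) → ℕ → Subset N
superlevel m s = Vec.tabulate (λ v → s ℕ.<ᵇ m v)

module _ {M N : ℕ} (P : IndicatorMatrix M N) (g : Fin M → ℕ) (m : Fin N → ℕ)
         (g≤m : ∀ e v → T (lookup (P e) v) → g e ℕ.≤ m v) where

  ⊆superlevel : ∀ s e → T (s ℕ.<ᵇ g e) → P e Subset.⊆ superlevel m s
  ⊆superlevel s e s<ge {v} v∈Pe = T-lookup⇒∈ (subst T (sym (Vec.lookup∘tabulate _ v))
    (ℕ.<⇒<ᵇ (ℕ.<-≤-trans (ℕ.<ᵇ⇒< s (g e) s<ge) (g≤m e v (∈⇒T-lookup v∈Pe)))))

  count-above≤containedCount : ∀ s → ∑ (allFin M) (λ e → 𝟙 (s ℕ.<ᵇ g e)) ℕ.≤ containedCount P (superlevel m s)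
  count-above≤containedCount s =
    subst (_ ℕ.≤_) (sym (length-filter≡∑ (λ e → P e ⊆? superlevel m s) (allFin M)))
      (∑-mono-≤ (allFin M) (λ e → 𝟙-mono (T-does (P e ⊆? superlevel m s) ∘ ⊆superlevel s e)))

  sparse-layer-cake : .{{_ : NonZero N}} {d : ℕ} {β : ℚ} → Sparse d β P → ∀ h → (∀ e → g e ℕ.≤ h) →
                      ℕ→ℚ N ^ℚ d * ℕ→ℚ (∑ (allFin M) g)
                        ≤ ℕ→ℚ M * ℕ→ℚ (∑ (downFrom h) (λ s → ∣ superlevel m s ∣ ℕ.^ d))
                          + ℕ→ℚ h * (β * ℕ→ℚ M * ℕ→ℚ N ^ℚ d)
  sparse-layer-cake {d} {β} sparse h g≤h =
    subst₂ (λ G k → Nᵈ * ℕ→ℚ G ≤ ℕ→ℚ M * ℕ→ℚ (∑ (downFrom h) (λ s → ∣ superlevel m s ∣ ℕ.^ d))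
                                 + ℕ→ℚ k * κ)
      (sym (layer-cake (allFin M) g h g≤h)) (length-downFrom h)
      (∑-affine-bound (downFrom h) {α = Nᵈ} {ℕ→ℚ M} {κ} layer)
    where
    Nᵈ = ℕ→ℚ N ^ℚ d
    κ  = β * ℕ→ℚ M * Nᵈ
    layer : ∀ s → Nᵈ * ℕ→ℚ (∑ (allFin M) (λ e → 𝟙 (s ℕ.<ᵇ g e)))
                    ≤ ℕ→ℚ M * ℕ→ℚ (∣ superlevel m s ∣ ℕ.^ d) + κ
    layer s = ℚ.≤-trans
      (*-monoˡ-≤-nonNeg (^ℚ-nonNeg d (ℕ→ℚ-nonNeg N)) (ℕ→ℚ-mono-≤ (count-above≤containedCount s)))
      (sparse-cleared {d = d} {β} P sparse (superlevel m s))

-- The expansion inequality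

module Expansion {M N t : ℕ} .{{_ : NonZero N}} .{{_ : NonZero t}} (t∣M : t ∣ M)
                 (P : IndicatorMatrix M N) {β : ℚ} (0≤β : 0ℚ ≤ β) (βt≤1 : β * ℕ→ℚ t ≤ 1ℚ) where

  c : ℚ
  c = 1ℚ - β * ℕ→ℚ t

  0≤c : 0ℚ ≤ c
  0≤c = 0≤1-x βt≤1

  Expands : ∀ {q} → ℕ → TupleSet M q → Set
  Expands {q} d E = c ^ℚ q * (ℕ→ℚ N ^ℚ q) ^ℚ d * ℕ→ℚ (cardT E) ≤ ℕ→ℚ M ^ℚ q * ℕ→ℚ (nbrCard P E) ^ℚ d

  expands-nullary : ∀ d (E : TupleSet M 0) → Expands d E
  expands-nullary d E = subst₂ (λ a b → 1ℚ * 1ℚ ^ℚ d * ℕ→ℚ a ≤ 1ℚ * ℕ→ℚ b ^ℚ d)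
    (sym (trans (cardT≡∑ E) (ℕ.+-identityʳ _)))
    (sym (trans (length-filter≡∑ (T? ∘ inNbrSet P E) (tuples N 0)) (trans (ℕ.+-identityʳ _) (cong 𝟙 member≡))))
    (indicator (E []))
    where
    member≡ : E [] ∧ true ∨ false ≡ E []
    member≡ = trans (∨-identityʳ _) (∧-identityʳ _)
    indicator : ∀ b → 1ℚ * 1ℚ ^ℚ d * ℕ→ℚ (𝟙 b) ≤ 1ℚ * ℕ→ℚ (𝟙 b) ^ℚ d
    indicator true  rewrite 1^ℚ d = ℚ.≤-refl
    indicator false rewrite 1^ℚ d = *-nonNeg (ℕ→ℚ-nonNeg 1) (^ℚ-nonNeg d ℚ.≤-refl)

  expands-exponent-zero : ∀ {q} (E : TupleSet M q) → Expands 0 E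
  expands-exponent-zero {q} E = begin
    c ^ℚ q * 1ℚ * ℕ→ℚ (cardT E)  ≡⟨ cong (_* ℕ→ℚ (cardT E)) (ℚ.*-identityʳ (c ^ℚ q)) ⟩
    c ^ℚ q * ℕ→ℚ (cardT E)       ≤⟨ *-mono-≤-nonNeg (^ℚ-nonNeg q 0≤c) (ℕ→ℚ-nonNeg (M ℕ.^ q)) cᵠ≤1
                                      (ℕ→ℚ-mono-≤ (cardT≤M^q E)) ⟩
    1ℚ * ℕ→ℚ (M ℕ.^ q)           ≡⟨ trans (ℚ.*-identityˡ _) (trans (ℕ→ℚ-homo-^ M q) (sym (ℚ.*-identityʳ _))) ⟩
    ℕ→ℚ M ^ℚ q * 1ℚ              ∎
    where
    open ℚ.≤-Reasoning
    cᵠ≤1 : c ^ℚ q ≤ 1ℚ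
    cᵠ≤1 = subst (c ^ℚ q ≤_) (1^ℚ q) (^ℚ-monoˡ-≤ q 0≤c (1-x≤1 (*-nonNeg 0≤β (ℕ→ℚ-nonNeg t))))

  module _ (d : ℕ) (sparse : Sparse (ℕ.suc d) β P) {q : ℕ} (E : TupleSet M (ℕ.suc q)) (legal : Legal t E) where

    private
      e = ℕ.suc d
      ⟦E⟧ = ℕ→ℚ (cardT E)
      Nᵉ = ℕ→ℚ N ^ℚ e
      m : Fin N → ℕ
      m = cardT ∘ link P E
      h = maxSlice E

    -- layer-profile vs = h ⊓ min_i m vᵢ, the number of layers s < h whose superlevel set contains vs.
    layer-profile : Vec (Fin N) e → ℕ
    layer-profile vs = ∑ (downFrom h) (λ s → ∏ (λ v → 𝟙 (s ℕ.<ᵇ m v)) vs)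

    layer-profile≤ : ∀ {vs v} → v ∈ᵛ vs → layer-profile vs ℕ.≤ m v
    layer-profile≤ {vs} {v} v∈vs = ℕ.≤-trans
      (∑-mono-≤ (downFrom h) (λ s → ∏𝟙≤𝟙 (λ w → s ℕ.<ᵇ m w) v∈vs))
      (ℕ.≤-trans (ℕ.≤-reflexive (∑-downFrom-<ᵇ h (m v))) (ℕ.m⊓n≤n h (m v)))

    ∑superlevel^≡∑layer-profile : ∑ (downFrom h) (λ s → ∣ superlevel m s ∣ ℕ.^ e) ≡ ∑ (tuples N e) layer-profile
    ∑superlevel^≡∑layer-profile = trans
      (∑-cong (downFrom h) (λ s → trans (cong (ℕ._^ e) (∣tabulate∣≡∑ N (λ v → s ℕ.<ᵇ m v)))
                                        (∑^≡∑∏ N e (λ v → 𝟙 (s ℕ.<ᵇ m v)))))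
      (∑-comm (downFrom h) (tuples N e) (λ s → ∏ (λ v → 𝟙 (s ℕ.<ᵇ m v))))

    maxSlice*M≤cardT*t : h ℕ.* M ℕ.≤ cardT E ℕ.* t
    maxSlice*M≤cardT*t = begin
      h ℕ.* M              ≡⟨ cong (h ℕ.*_) (sym (m/n*n≡m t∣M)) ⟩
      h ℕ.* (M / t ℕ.* t)  ≡⟨ sym (ℕ.*-assoc h (M / t) t) ⟩
      h ℕ.* (M / t) ℕ.* t  ≤⟨ ℕ.*-monoˡ-≤ t (maxSlice*[M/t]≤cardT E legal) ⟩
      cardT E ℕ.* t        ∎
      where open ℕ.≤-Reasoning

    private
      ⟦S⟧ = ℕ→ℚ (∑ (tuples N e) layer-profile)

    layer-cake-bound : Nᵉ * ⟦E⟧ ≤ ℕ→ℚ M * ⟦S⟧ + ℕ→ℚ h * (β * ℕ→ℚ M * Nᵉ)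
    layer-cake-bound = subst₂ (λ x y → Nᵉ * ℕ→ℚ x ≤ ℕ→ℚ M * ℕ→ℚ y + ℕ→ℚ h * (β * ℕ→ℚ M * Nᵉ))
      (sym (cardT≡∑slices E)) ∑superlevel^≡∑layer-profile
      (sparse-layer-cake P (cardT ∘ slice E) m (λ _ _ → cardT-slice≤cardT-link P E) {e} {β} sparse
                         h (slice≤maxSlice E))

    top-layers-bound : ℕ→ℚ h * (β * ℕ→ℚ M * Nᵉ) ≤ β * ℕ→ℚ t * Nᵉ * ⟦E⟧
    top-layers-bound = begin
      ℕ→ℚ h * (β * ℕ→ℚ M * Nᵉ)    ≡⟨ regroup (ℕ→ℚ h) β (ℕ→ℚ M) Nᵉ ⟩
      (ℕ→ℚ h * ℕ→ℚ M) * (β * Nᵉ)  ≤⟨ *-monoʳ-≤-nonNeg (*-nonNeg 0≤β (^ℚ-nonNeg e (ℕ→ℚ-nonNeg N))) hM≤Et ⟩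
      (⟦E⟧ * ℕ→ℚ t) * (β * Nᵉ)    ≡⟨ regroup′ ⟦E⟧ (ℕ→ℚ t) β Nᵉ ⟩
      β * ℕ→ℚ t * Nᵉ * ⟦E⟧        ∎
      where
      open ℚ.≤-Reasoning
      hM≤Et : ℕ→ℚ h * ℕ→ℚ M ≤ ⟦E⟧ * ℕ→ℚ t
      hM≤Et = subst₂ _≤_ (ℕ→ℚ-homo-* h M) (ℕ→ℚ-homo-* (cardT E) t) (ℕ→ℚ-mono-≤ maxSlice*M≤cardT*t)
      regroup : ∀ x b y n → x * (b * y * n) ≡ (x * y) * (b * n)
      regroup = solve-∀ ℚ-ring
      regroup′ : ∀ x y b n → (x * y) * (b * n) ≡ b * y * n * x
      regroup′ = solve-∀ ℚ-ring

    c*Nᵉ*cardT≤M*∑layer-profile : c * Nᵉ * ⟦E⟧ ≤ ℕ→ℚ M * ⟦S⟧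
    c*Nᵉ*cardT≤M*∑layer-profile = begin
      c * Nᵉ * ⟦E⟧         ≡⟨ expand β (ℕ→ℚ t) Nᵉ ⟦E⟧ ⟩
      Nᵉ * ⟦E⟧ - κ         ≤⟨ ℚ.+-monoˡ-≤ (ℚ.- κ) (ℚ.≤-trans layer-cake-bound
                                                      (ℚ.+-monoʳ-≤ (ℕ→ℚ M * ⟦S⟧) top-layers-bound)) ⟩
      ℕ→ℚ M * ⟦S⟧ + κ - κ  ≡⟨ cancel (ℕ→ℚ M * ⟦S⟧) κ ⟩
      ℕ→ℚ M * ⟦S⟧          ∎
      where
      open ℚ.≤-Reasoning
      κ = β * ℕ→ℚ t * Nᵉ * ⟦E⟧
      expand : ∀ b y n x → (1ℚ - b * y) * n * x ≡ n * x - b * y * n * x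
      expand = solve-∀ ℚ-ring
      cancel : ∀ y w → y + w - w ≡ y
      cancel = solve-∀ ℚ-ring

    module _ (ih : ∀ (E′ : TupleSet M q) → Legal t E′ → Expands e E′) where

      private
        scale = c ^ℚ q * (ℕ→ℚ N ^ℚ q) ^ℚ e
        0≤scale : 0ℚ ≤ scale
        0≤scale = *-nonNeg (^ℚ-nonNeg q 0≤c) (^ℚ-nonNeg e (^ℚ-nonNeg q (ℕ→ℚ-nonNeg N)))
        n : Fin N → ℕ
        n = nbrCard P ∘ link P E

      layer-profile-bound : ∀ vs → scale * ℕ→ℚ (layer-profile vs) ≤ ℕ→ℚ M ^ℚ q * ℕ→ℚ (∏ n vs)
      layer-profile-bound vs =
        ≤-*∏-from-≤-*^ n vs (^ℚ-nonNeg q (ℕ→ℚ-nonNeg M)) (*-nonNeg 0≤scale (ℕ→ℚ-nonNeg (layer-profile vs)))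
          (λ {v} v∈vs → ℚ.≤-trans (*-monoˡ-≤-nonNeg 0≤scale (ℕ→ℚ-mono-≤ (layer-profile≤ v∈vs)))
                                  (ih (link P E v) (legal-link P E legal v)))

      ∑layer-profile-bound : scale * ⟦S⟧ ≤ ℕ→ℚ M ^ℚ q * ℕ→ℚ (nbrCard P E) ^ℚ e
      ∑layer-profile-bound = subst (scale * ⟦S⟧ ≤_) (cong (ℕ→ℚ M ^ℚ q *_) ∑∏n≡)
        (∑-linear-bound (tuples N e) {layer-profile} {∏ n} {scale} {ℕ→ℚ M ^ℚ q} layer-profile-bound)
        where
        ∑∏n≡ : ℕ→ℚ (∑ (tuples N e) (∏ n)) ≡ ℕ→ℚ (nbrCard P E) ^ℚ e
        ∑∏n≡ = begin
          ℕ→ℚ (∑ (tuples N e) (∏ n))  ≡⟨ cong ℕ→ℚ (sym (∑^≡∑∏ N e n)) ⟩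
          ℕ→ℚ (∑ (allFin N) n ℕ.^ e)  ≡⟨ cong (λ x → ℕ→ℚ (x ℕ.^ e)) (sym (nbrCard≡∑links P E)) ⟩
          ℕ→ℚ (nbrCard P E ℕ.^ e)     ≡⟨ ℕ→ℚ-homo-^ (nbrCard P E) e ⟩
          ℕ→ℚ (nbrCard P E) ^ℚ e      ∎
          where open ≡-Reasoning

      expands-step : Expands e E
      expands-step = begin
        c * c ^ℚ q * (ℕ→ℚ N * ℕ→ℚ N ^ℚ q) ^ℚ e * ⟦E⟧
          ≡⟨ cong (λ x → c * c ^ℚ q * x * ⟦E⟧) (^ℚ-distribʳ-* (ℕ→ℚ N) (ℕ→ℚ N ^ℚ q) e) ⟩
        c * c ^ℚ q * (Nᵉ * (ℕ→ℚ N ^ℚ q) ^ℚ e) * ⟦E⟧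
          ≡⟨ regroup c (c ^ℚ q) Nᵉ ((ℕ→ℚ N ^ℚ q) ^ℚ e) ⟦E⟧ ⟩
        scale * (c * Nᵉ * ⟦E⟧)
          ≤⟨ *-monoˡ-≤-nonNeg 0≤scale c*Nᵉ*cardT≤M*∑layer-profile ⟩
        scale * (ℕ→ℚ M * ⟦S⟧)
          ≡⟨ swap scale (ℕ→ℚ M) ⟦S⟧ ⟩
        ℕ→ℚ M * (scale * ⟦S⟧)
          ≤⟨ *-monoˡ-≤-nonNeg (ℕ→ℚ-nonNeg M) ∑layer-profile-bound ⟩
        ℕ→ℚ M * (ℕ→ℚ M ^ℚ q * ℕ→ℚ (nbrCard P E) ^ℚ e)
          ≡⟨ sym (ℚ.*-assoc (ℕ→ℚ M) _ _) ⟩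
        ℕ→ℚ M * ℕ→ℚ M ^ℚ q * ℕ→ℚ (nbrCard P E) ^ℚ e ∎
        where
        open ℚ.≤-Reasoning
        regroup : ∀ c cq n nq x → c * cq * (n * nq) * x ≡ cq * nq * (c * n * x)
        regroup = solve-∀ ℚ-ring
        swap : ∀ a m s → a * (m * s) ≡ m * (a * s)
        swap = solve-∀ ℚ-ring

  expands : ∀ d → Sparse d β P → ∀ {q} (E : TupleSet M q) → Legal t E → Expands d E
  expands ℕ.zero    _                  E _     = expands-exponent-zero E
  expands (ℕ.suc d) _      {ℕ.zero}  E _     = expands-nullary (ℕ.suc d) E
  expands (ℕ.suc d) sparse {ℕ.suc q} E legal =
    expands-step d sparse E legal (λ E′ → expands (ℕ.suc d) sparse E′)

theorem4p9 : (d N M t : ℕ) → .{{_ : NonZero N}} → .{{_ : NonZero t}}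
    → (P : IndicatorMatrix M N)
    → (∀ e → ∣ P e ∣ ≡ d)
    → Injective _≡_ _≡_ P
    → (β : ℚ) → 0ℚ ≤ β → β ≤ 1ℚ
    → t ∣ M
    → β * ℕ→ℚ t < 1ℚ
    → (∀ (V' : Subset N) → ℕ→ℚ (containedCount P V')
         ≤ ((+ ∣ V' ∣ ℚ./ N) ^ℚ d) * ℕ→ℚ M + β * ℕ→ℚ M)
    → ∀ (q : ℕ) → .{{_ : NonZero q}}
    → (E' : TupleSet M q)
    → (∀ (ℓ : Fin q) (e : Vec (Fin M) q) → lineCount E' ℓ e ≡ 0 ⊎ M / t ℕ.≤ lineCount E' ℓ e)
    → ∀ (δ : ℚ) → 0ℚ ≤ δ → δ ≤ 1ℚ
    → (ℕ→ℚ M ^ℚ q) * (δ ^ℚ d) < ℕ→ℚ (cardT E') * ((1ℚ - β * ℕ→ℚ t) ^ℚ q)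
    → (ℕ→ℚ N ^ℚ q) * δ < ℕ→ℚ (nbrCard P E')
theorem4p9 d N M t P _ _ β 0≤β _ t∣M βt<1 sparse q E′ legal δ _ _ dense =
  ^ℚ-cancelˡ-< d (ℕ→ℚ-nonNeg (nbrCard P E′))
    (ℚ.*-cancelˡ-<-nonNeg Mᵠ {{ℚ.nonNegative (^ℚ-nonNeg q (ℕ→ℚ-nonNeg M))}} (begin-strict
      Mᵠ * (Nᵠ * δ) ^ℚ d                 ≡⟨ cong (Mᵠ *_) (^ℚ-distribʳ-* Nᵠ δ d) ⟩
      Mᵠ * (Nᵠ ^ℚ d * δ ^ℚ d)            ≡⟨ swap Mᵠ (Nᵠ ^ℚ d) (δ ^ℚ d) ⟩
      Mᵠ * δ ^ℚ d * Nᵠ ^ℚ d              <⟨ ℚ.*-monoˡ-<-pos (Nᵠ ^ℚ d) {{ℚ.positive 0<Nᵠᵈ}} dense ⟩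
      ℕ→ℚ (cardT E′) * c ^ℚ q * Nᵠ ^ℚ d  ≡⟨ rotate (ℕ→ℚ (cardT E′)) (c ^ℚ q) (Nᵠ ^ℚ d) ⟩
      c ^ℚ q * Nᵠ ^ℚ d * ℕ→ℚ (cardT E′)  ≤⟨ expands d sparse E′ legal ⟩
      Mᵠ * ℕ→ℚ (nbrCard P E′) ^ℚ d       ∎))
  where
  open Expansion t∣M P 0≤β (ℚ.<⇒≤ βt<1)
  open ℚ.≤-Reasoning
  Mᵠ = ℕ→ℚ M ^ℚ q
  Nᵠ = ℕ→ℚ N ^ℚ q
  0<Nᵠᵈ : 0ℚ < Nᵠ ^ℚ d
  0<Nᵠᵈ = ^ℚ-pos d (^ℚ-pos q (ℕ→ℚ-pos N))
  swap : ∀ m n x → m * (n * x) ≡ m * x * n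
  swap = solve-∀ ℚ-ring
  rotate : ∀ x y z → x * y * z ≡ y * z * x
  rotate = solve-∀ ℚ-ring
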